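{- Let $W$ be the directed graph with vertex set $\{c,u,v,w,z\}$ and edge set $\{(u,v),(w,v),(w,z),(u,z),(v,c),(z,c),(c,w),(c,u)\}$ (a $4$-wheel with center $c$ and rim cycle $(u,v,w,z)$, in which $v$ and $z$ are sinks of the rim and $u$ and $w$ are sources of the rim). In any planar L-drawing of $W$ in which the cycle $(u,v,w,z)$ bounds the outer face, the drawings of the four edges of the outer face form (the boundary of) an axis-parallel rectangle, which contains the vertex $c$.
   Context: An L-drawing of a directed graph $G=(V,E)$ assigns to each vertex a point of the plane with integer coordinates such that no two vertices share an $x$-coordinate or a $y$-coordinate, and draws each directed edge $(u,v)$ as a one-bend orthogonal polyline consisting of a vertical segment incident to $u$ followed by a horizontal segment incident to $v$. Drawings of distinct edges may partially overlap and may cross; bends and crossings are distinguished by regarding each bend as a small rounded junction. An L-drawing is planar if no two edges cross (overlaps are allowed). -}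

module Defs where

open import Data.Integer using (ℤ; _<_; _≤_; _<?_; _≤?_; +_; -_; _+_)
open import Data.Product using (_×_; _,_; proj₁; proj₂)
open import Data.Sum using (_⊎_)
open import Data.List using (List; []; _∷_; _++_)
open import Data.Bool using (if_then_else_; _∧_)
open import Relation.Nullary using (¬_; does)
open import Relation.Binary.PropositionalEquality using (_≡_)

Point : Set
Point = ℤ × ℤ

StrictlyBetween : ℤ → ℤ → ℤ → Set
StrictlyBetween m lo hi = (lo < m × m < hi) ⊎ (hi < m × m < lo)

record LDrawing (V : Set) : Set where
  field
    X : V → ℤ
    Y : V → ℤ
    X-inj : ∀ a b → X a ≡ X b → a ≡ b
    Y-inj : ∀ a b → Y a ≡ Y b → a ≡ b

  pos : V → Point
  pos a = (X a , Y a)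

  -- the bend of the L-shaped drawing of the directed edge (a , b):
  -- vertical segment from pos a to (X a , Y b), then horizontal
  -- segment from (X a , Y b) to pos b.
  bend : V → V → Point
  bend a b = (X a , Y b)

open LDrawing public

-- The drawings of the directed edges (a,b) and (p,q) cross:
-- the vertical segment of (a,b) and the horizontal segment of (p,q)
-- meet in a point interior to both segments.  (All other common points
-- of two edge drawings are endpoints, overlaps of edges with a common
-- tail / common head, or rounded bends on such overlaps, which are not
-- crossings.)
Cross : {V : Set} → LDrawing V → V → V → V → V → Set
Cross D a b p q =
  StrictlyBetween (Y D q) (Y D a) (Y D b) × StrictlyBetween (X D a) (X D p) (X D q)

PlanarL : {V : Set} → (V → V → Set) → LDrawing V → Set
PlanarL {V} E D = ∀ (a b p q : V) → E a b → E p q → ¬ Cross D a b p q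

-- Winding number of a closed axis-parallel polygon around a point
-- (signed count of crossings with the rightward horizontal ray from o,
-- using the half-open rule at endpoints).  Valid for polygons whose
-- consecutive points differ in only one coordinate.

segWind : Point → Point → Point → ℤ
segWind (px , py) (qx , qy) (ox , oy) =
  if does (ox <? px)
  then (if does (py ≤? oy) ∧ does (oy <? qy) then + 1
        else if does (qy ≤? oy) ∧ does (oy <? py) then - (+ 1)
        else + 0)
  else + 0

private
  windFrom : Point → List Point → Point → ℤ
  windFrom first [] o = + 0
  windFrom first (p ∷ []) o = segWind p first o
  windFrom first (p ∷ q ∷ ps) o = segWind p q o + windFrom first (q ∷ ps) o

winding : List Point → Point → ℤ
winding [] o = + 0
winding (p ∷ ps) o = windFrom p (p ∷ ps) o

data VW : Set where
  c u v w z : VW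

data EW : VW → VW → Set where
  uv : EW u v
  wv : EW w v
  wz : EW w z
  uz : EW u z
  vc : EW v c
  zc : EW z c
  cw : EW c w
  cu : EW c u

-- The drawing of the rim cycle (u,v,w,z) as a closed polygon, traversing
-- (u,v) forwards, (w,v) backwards, (w,z) forwards, (u,z) backwards:
-- u → bend(u,v) → v → bend(w,v) → w → bend(w,z) → z → bend(u,z) → u
rimPolygon : LDrawing VW → List Point
rimPolygon D =
  pos D u ∷ bend D u v ∷ pos D v ∷ bend D w v ∷
  pos D w ∷ bend D w z ∷ pos D z ∷ bend D u z ∷ []

-- The rim cycle (u,v,w,z) bounds the outer face: the rest of the drawing
-- (vertex c) lies in the bounded region of the rim polygon, i.e. the
-- rim winds around c.
RimBoundsOuterFace : LDrawing VW → Set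
RimBoundsOuterFace D = ¬ (winding (rimPolygon D) (pos D c) ≡ + 0)

-- The drawings of the four rim edges form the boundary of the
-- axis-parallel rectangle with corners (X u , Y v) and (X w , Y z):
-- u and w lie in the interiors of the two vertical sides, v and z in the
-- interiors of the two horizontal sides, and the four bends are the corners.
RimIsRectangle : LDrawing VW → Set
RimIsRectangle D =
  StrictlyBetween (X D v) (X D u) (X D w) ×
  StrictlyBetween (X D z) (X D u) (X D w) ×
  StrictlyBetween (Y D u) (Y D v) (Y D z) ×
  StrictlyBetween (Y D w) (Y D v) (Y D z)

CenterInRectangle : LDrawing VW → Set
CenterInRectangle D =
  StrictlyBetween (X D c) (X D u) (X D w) ×
  StrictlyBetween (Y D c) (Y D v) (Y D z)

-- The rim polygon has four vertical sides, on the lines x = X u and x = X w, and its winding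
-- number around a point o telescopes to ([ox < X w] − [ox < X u]) · ([Y v ≤ oy] − [Y z ≤ oy]).
-- So it winds around c exactly when c lies strictly between u and w horizontally and strictly
-- between v and z vertically.  Planarity then pins the rim vertices: if, say, X v were not
-- strictly between X u and X w, the horizontal segment of (v , c) would pass the line x = X u
-- (or x = X w) at height Y c, which lies between Y v and Y z, and so would cross the vertical
-- segment of (u , v) or of (u , z), whichever spans height Y c.  Dually, the horizontal
-- segments of (u , v) and (w , v) at height Y v together span the abscissa X c, so the vertical
-- segment of (c , u) cannot pass height Y v; likewise for z and for (c , w).
module Submission where

open import Defs
open import Data.Bool using (Bool; true; false; not)
open import Data.Integer using (ℤ; _<_; _<?_; _≤?_; +_; _+_; _-_; _*_)
open import Data.Integer.Properties
  using (<-cmp; ≤∧≢⇒<; ≮⇒≥; ≰⇒>; <-≤-trans; <-irrefl; +-inverseʳ; *-zeroʳ)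
open import Data.Integer.Tactic.RingSolver using (solve-∀)
open import Data.Product using (_×_; _,_; proj₁; proj₂)
open import Data.Sum using (_⊎_; inj₁; inj₂)
open import Data.Empty using (⊥-elim)
open import Data.List using (_∷_; [])
open import Function using (_∘_)
open import Relation.Binary using (tri<; tri≈; tri>)
open import Relation.Binary.PropositionalEquality using (_≡_; _≢_; refl; trans; cong; ≢-sym)
open import Relation.Nullary using (¬_; does; yes; no)

StrictlyBetween-sym : ∀ {m lo hi} → StrictlyBetween m lo hi → StrictlyBetween m hi lo
StrictlyBetween-sym (inj₁ p) = inj₂ p
StrictlyBetween-sym (inj₂ p) = inj₁ p

StrictlyBetween-split : ∀ {m lo hi} x → StrictlyBetween m lo hi → m ≢ x →
                        StrictlyBetween m x lo ⊎ StrictlyBetween m x hi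
StrictlyBetween-split {m} x (inj₁ (lo<m , m<hi)) m≢x with <-cmp m x
... | tri< m<x _ _ = inj₁ (inj₂ (lo<m , m<x))
... | tri≈ _ m≡x _ = ⊥-elim (m≢x m≡x)
... | tri> _ _ x<m = inj₂ (inj₁ (x<m , m<hi))
StrictlyBetween-split {m} x (inj₂ (hi<m , m<lo)) m≢x with <-cmp m x
... | tri< m<x _ _ = inj₂ (inj₂ (hi<m , m<x))
... | tri≈ _ m≡x _ = ⊥-elim (m≢x m≡x)
... | tri> _ _ x<m = inj₁ (inj₁ (x<m , m<lo))

above-unless-separated : ∀ {lo m x} → lo < m → x ≢ lo → ¬ StrictlyBetween lo x m → lo < x
above-unless-separated {lo} {x = x} lo<m x≢lo unseparated with <-cmp x lo
... | tri< x<lo _ _ = ⊥-elim (unseparated (inj₁ (x<lo , lo<m)))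
... | tri≈ _ x≡lo _ = ⊥-elim (x≢lo x≡lo)
... | tri> _ _ lo<x = lo<x

below-unless-separated : ∀ {hi m x} → m < hi → x ≢ hi → ¬ StrictlyBetween hi x m → x < hi
below-unless-separated {hi} {x = x} m<hi x≢hi unseparated with <-cmp x hi
... | tri< x<hi _ _ = x<hi
... | tri≈ _ x≡hi _ = ⊥-elim (x≢hi x≡hi)
... | tri> _ _ hi<x = ⊥-elim (unseparated (inj₂ (m<hi , hi<x)))

StrictlyBetween-unless-separated :
  ∀ {m lo hi x} → StrictlyBetween m lo hi → x ≢ lo → x ≢ hi →
  ¬ StrictlyBetween lo x m → ¬ StrictlyBetween hi x m → StrictlyBetween x lo hi
StrictlyBetween-unless-separated (inj₁ (lo<m , m<hi)) x≢lo x≢hi sep-lo sep-hi =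
  inj₁ (above-unless-separated lo<m x≢lo sep-lo , below-unless-separated m<hi x≢hi sep-hi)
StrictlyBetween-unless-separated (inj₂ (hi<m , m<lo)) x≢lo x≢hi sep-lo sep-hi =
  inj₂ (above-unless-separated hi<m x≢hi sep-hi , below-unless-separated m<lo x≢lo sep-lo)

<?-disagree⇒StrictlyBetween : ∀ {x a b} → does (x <? a) ≢ does (x <? b) → x ≢ a → x ≢ b →
                              StrictlyBetween x a b
<?-disagree⇒StrictlyBetween {x} {a} {b} differ x≢a x≢b with x <? a | x <? b
... | yes _   | yes _   = ⊥-elim (differ refl)
... | yes x<a | no x≮b  = inj₂ (≤∧≢⇒< (≮⇒≥ x≮b) (≢-sym x≢b) , x<a)
... | no x≮a  | yes x<b = inj₁ (≤∧≢⇒< (≮⇒≥ x≮a) (≢-sym x≢a) , x<b)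
... | no _    | no _    = ⊥-elim (differ refl)

≤?-disagree⇒StrictlyBetween : ∀ {y a b} → does (a ≤? y) ≢ does (b ≤? y) → y ≢ a → y ≢ b →
                              StrictlyBetween y a b
≤?-disagree⇒StrictlyBetween {y} {a} {b} differ y≢a y≢b with a ≤? y | b ≤? y
... | yes _   | yes _   = ⊥-elim (differ refl)
... | yes a≤y | no b≰y  = inj₁ (≤∧≢⇒< a≤y (≢-sym y≢a) , ≰⇒> b≰y)
... | no a≰y  | yes b≤y = inj₂ (≤∧≢⇒< b≤y (≢-sym y≢b) , ≰⇒> a≰y)
... | no _    | no _    = ⊥-elim (differ refl)

does-<?≡not-≤? : ∀ x y → does (x <? y) ≡ not (does (y ≤? x))
does-<?≡not-≤? x y with x <? y | y ≤? x
... | yes x<y | yes y≤x = ⊥-elim (<-irrefl refl (<-≤-trans x<y y≤x))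
... | yes _   | no _    = refl
... | no _    | yes _   = refl
... | no x≮y  | no y≰x  = ⊥-elim (x≮y (≰⇒> y≰x))

indicator : Bool → ℤ
indicator true  = + 1
indicator false = + 0

differences-*≢0⇒differ : ∀ s t a b → (indicator s - indicator t) * (indicator a - indicator b) ≢ + 0 →
                         s ≢ t × a ≢ b
differences-*≢0⇒differ s t a b ≢0 =
  (λ { refl → ≢0 (cong (_* (indicator a - indicator b)) (+-inverseʳ (indicator s))) }) ,
  (λ { refl → ≢0 (trans (cong ((indicator s - indicator t) *_) (+-inverseʳ (indicator a)))
                        (*-zeroʳ (indicator s - indicator t))) })

segWind-vertical : ∀ x a b ox oy →
  segWind (x , a) (x , b) (ox , oy) ≡
  indicator (does (ox <? x)) * (indicator (does (a ≤? oy)) - indicator (does (b ≤? oy)))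
segWind-vertical x a b ox oy
  rewrite does-<?≡not-≤? oy b | does-<?≡not-≤? oy a
  with does (ox <? x) | does (a ≤? oy) | does (b ≤? oy)
... | false | _     | _     = refl
... | true  | true  | true  = refl
... | true  | true  | false = refl
... | true  | false | true  = refl
... | true  | false | false = refl

segWind-horizontal : ∀ px qx y o → segWind (px , y) (qx , y) o ≡ + 0
segWind-horizontal px qx y (ox , oy) rewrite does-<?≡not-≤? oy y
  with does (ox <? px) | does (y ≤? oy)
... | false | _     = refl
... | true  | true  = refl
... | true  | false = refl

-- Only the four vertical sides contribute, and their contributions telescope.
winding-octagon :
  ∀ x₁ x₂ x₃ x₄ y₁ y₂ y₃ y₄ ox oy →
  winding ((x₁ , y₁) ∷ (x₁ , y₂) ∷ (x₂ , y₂) ∷ (x₃ , y₂) ∷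
           (x₃ , y₃) ∷ (x₃ , y₄) ∷ (x₄ , y₄) ∷ (x₁ , y₄) ∷ []) (ox , oy) ≡
  (indicator (does (ox <? x₃)) - indicator (does (ox <? x₁))) *
  (indicator (does (y₂ ≤? oy)) - indicator (does (y₄ ≤? oy)))
winding-octagon x₁ x₂ x₃ x₄ y₁ y₂ y₃ y₄ ox oy
  rewrite segWind-vertical x₁ y₁ y₂ ox oy
        | segWind-horizontal x₁ x₂ y₂ (ox , oy)
        | segWind-horizontal x₂ x₃ y₂ (ox , oy)
        | segWind-vertical x₃ y₂ y₃ ox oy
        | segWind-vertical x₃ y₃ y₄ ox oy
        | segWind-horizontal x₃ x₄ y₄ (ox , oy)
        | segWind-horizontal x₄ x₁ y₄ (ox , oy)
        | segWind-vertical x₁ y₄ y₁ ox oy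
  = telescope (indicator (does (ox <? x₁))) (indicator (does (ox <? x₃)))
              (indicator (does (y₁ ≤? oy))) (indicator (does (y₂ ≤? oy)))
              (indicator (does (y₃ ≤? oy))) (indicator (does (y₄ ≤? oy)))
  where
  telescope : ∀ s t a₁ a₂ a₃ a₄ →
    s * (a₁ - a₂) + (+ 0 + (+ 0 + (t * (a₂ - a₃) + (t * (a₃ - a₄) + (+ 0 + (+ 0 + s * (a₄ - a₁))))))) ≡
    (t - s) * (a₂ - a₄)
  telescope = solve-∀

module _ {V : Set} (D : LDrawing V) where

  X-≢ : ∀ {a b} → a ≢ b → X D a ≢ X D b
  X-≢ a≢b = a≢b ∘ X-inj D _ _

  Y-≢ : ∀ {a b} → a ≢ b → Y D a ≢ Y D b
  Y-≢ a≢b = a≢b ∘ Y-inj D _ _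

module _ {V : Set} {E : V → V → Set} (D : LDrawing V) (planar : PlanarL E D) where

  out-fork-blocks-horizontal :
    ∀ {a b₁ b₂ p q} → E a b₁ → E a b₂ → E p q →
    StrictlyBetween (Y D q) (Y D b₁) (Y D b₂) → q ≢ a → ¬ StrictlyBetween (X D a) (X D p) (X D q)
  out-fork-blocks-horizontal {a} ab₁ ab₂ pq q-between q≢a a-between
    with StrictlyBetween-split (Y D a) q-between (Y-≢ D q≢a)
  ... | inj₁ q-under-ab₁ = planar _ _ _ _ ab₁ pq (q-under-ab₁ , a-between)
  ... | inj₂ q-under-ab₂ = planar _ _ _ _ ab₂ pq (q-under-ab₂ , a-between)

  in-fork-blocks-vertical :
    ∀ {p₁ p₂ q a b} → E p₁ q → E p₂ q → E a b →
    StrictlyBetween (X D a) (X D p₁) (X D p₂) → a ≢ q → ¬ StrictlyBetween (Y D q) (Y D a) (Y D b)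
  in-fork-blocks-vertical {q = q} p₁q p₂q ab a-between a≢q q-between
    with StrictlyBetween-split (X D q) a-between (X-≢ D a≢q)
  ... | inj₁ a-over-p₁q = planar _ _ _ _ ab p₁q (q-between , StrictlyBetween-sym a-over-p₁q)
  ... | inj₂ a-over-p₂q = planar _ _ _ _ ab p₂q (q-between , StrictlyBetween-sym a-over-p₂q)

rimBoundsOuterFace⇒centerInRectangle : ∀ D → RimBoundsOuterFace D → CenterInRectangle D
rimBoundsOuterFace⇒centerInRectangle D outer =
  <?-disagree⇒StrictlyBetween (≢-sym (proj₁ differ)) (X-≢ D (λ ())) (X-≢ D (λ ())) ,
  ≤?-disagree⇒StrictlyBetween (proj₂ differ) (Y-≢ D (λ ())) (Y-≢ D (λ ()))
  where
  differ : does (X D c <? X D w) ≢ does (X D c <? X D u) ×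
           does (Y D v ≤? Y D c) ≢ does (Y D z ≤? Y D c)
  differ = differences-*≢0⇒differ _ _ _ _
    (outer ∘ trans (winding-octagon (X D u) (X D v) (X D w) (X D z)
                                    (Y D u) (Y D v) (Y D w) (Y D z) (X D c) (Y D c)))

centerInRectangle⇒rimIsRectangle : ∀ D → PlanarL EW D → CenterInRectangle D → RimIsRectangle D
centerInRectangle⇒rimIsRectangle D planar (c-x , c-y) =
  StrictlyBetween-unless-separated c-x (X-≢ D (λ ())) (X-≢ D (λ ()))
    (blocks-horizontal uv uz vc (λ ())) (blocks-horizontal wv wz vc (λ ())) ,
  StrictlyBetween-unless-separated c-x (X-≢ D (λ ())) (X-≢ D (λ ()))
    (blocks-horizontal uv uz zc (λ ())) (blocks-horizontal wv wz zc (λ ())) ,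
  StrictlyBetween-unless-separated c-y (Y-≢ D (λ ())) (Y-≢ D (λ ()))
    (blocks-vertical uv wv cu (λ ())) (blocks-vertical uz wz cu (λ ())) ,
  StrictlyBetween-unless-separated c-y (Y-≢ D (λ ())) (Y-≢ D (λ ()))
    (blocks-vertical uv wv cw (λ ())) (blocks-vertical uz wz cw (λ ()))
  where
  blocks-horizontal : ∀ {a p} → EW a v → EW a z → EW p c → c ≢ a →
                      ¬ StrictlyBetween (X D a) (X D p) (X D c)
  blocks-horizontal av az pc c≢a = out-fork-blocks-horizontal D planar av az pc c-y c≢a

  blocks-vertical : ∀ {q b} → EW u q → EW w q → EW c b → c ≢ q →
                    ¬ StrictlyBetween (Y D q) (Y D b) (Y D c)
  blocks-vertical uq wq cb c≢q = in-fork-blocks-vertical D planar uq wq cb c-x c≢q ∘ StrictlyBetween-sym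

lemma2 : (D : LDrawing VW) → PlanarL EW D → RimBoundsOuterFace D →
    RimIsRectangle D × CenterInRectangle D
lemma2 D planar outer = centerInRectangle⇒rimIsRectangle D planar center , center
  where
  center : CenterInRectangle D
  center = rimBoundsOuterFace⇒centerInRectangle D outer
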